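{- Let $C$ be a lattice cone and $x\in C$. Then for any two partitions $\pi_1,\pi_2$ of $x$ there exists a partition $\pi$ of $x$ that refines both $\pi_1$ and $\pi_2$; i.e. the set $\mathcal{P}(x)$ of partitions of $x$ is directed for the refinement order.
   Context: A cone $C$ is an $\mathbb{R}_{\ge 0}$-semimodule with a function $\|\cdot\|_C:C\to\mathbb{R}_{\ge0}$ such that for all $x,x',y,y'\in C$, $\alpha\ge0$: $x+y=x+y'\Rightarrow y=y'$; $\|\alpha x\|_C=\alpha\|x\|_C$; $\|x+x'\|_C\le\|x\|_C+\|x'\|_C$; $\|x\|_C=0\Rightarrow x=0$; $\|x\|_C\le\|x+x'\|_C$. It is ordered by $x\le y$ iff $y=x+z$ for some $z\in C$. $C$ is a lattice cone if any two elements of $C$ have a least upper bound for this order. A partition of $x\in C$ is a finite multiset $[y_1,\ldots,y_m]$ of elements of $C$ with $\sum_j y_j=x$. A partition $\pi'$ refines $\pi=[y_1,\ldots,y_m]$ if $\pi'=\alpha_1+\cdots+\alpha_m$ (multiset union) where each $\alpha_j$ is a partition of $y_j$. -}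

module Defs where

open import Level using (0ℓ)
open import Data.Product using (Σ; ∃; _×_; _,_)
open import Data.List using (List; []; _∷_; foldr; concat)
open import Data.List.Relation.Binary.Pointwise using (Pointwise)
open import Data.List.Relation.Binary.Permutation.Propositional using (_↭_)
open import Relation.Binary.PropositionalEquality using (_≡_)
open import Relation.Binary.Structures using (IsTotalOrder)
open import Relation.Nullary using (¬_)
open import Algebra.Structures using (IsCommutativeRing; IsCommutativeMonoid)

-- The real numbers, given axiomatically as a complete (Dedekind)
-- ordered field.  (agda-stdlib has no reals; any two models are
-- isomorphic, so quantifying over all models is faithful.)

record RealNumbers : Set₁ where
  infixl 6 _+_
  infixl 7 _*_
  infix  4 _≤_
  field
    ℝ     : Set
    _+_   : ℝ → ℝ → ℝ
    _*_   : ℝ → ℝ → ℝ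
    -_    : ℝ → ℝ
    0ℝ    : ℝ
    1ℝ    : ℝ
    _⁻¹   : ℝ → ℝ
    _≤_   : ℝ → ℝ → Set
    isCommutativeRing : IsCommutativeRing _≡_ _+_ _*_ -_ 0ℝ 1ℝ
    0≢1   : ¬ (0ℝ ≡ 1ℝ)
    ⁻¹-inverse : ∀ x → ¬ (x ≡ 0ℝ) → x * (x ⁻¹) ≡ 1ℝ
    isTotalOrder : IsTotalOrder _≡_ _≤_
    +-mono-≤ : ∀ x y z → x ≤ y → x + z ≤ y + z
    *-nonneg : ∀ x y → 0ℝ ≤ x → 0ℝ ≤ y → 0ℝ ≤ x * y
    complete : (P : ℝ → Set) → (∃ λ x → P x) → (∃ λ b → ∀ x → P x → x ≤ b) →
               ∃ λ s → (∀ x → P x → x ≤ s) × (∀ b → (∀ x → P x → x ≤ b) → s ≤ b)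

module _ (Rl : RealNumbers) where
  open RealNumbers Rl

  record Cone : Set₁ where
    infixl 6 _⊕_
    infixr 7 _·_
    field
      Carrier : Set
      _⊕_     : Carrier → Carrier → Carrier
      𝟘       : Carrier
      _·_     : Σ ℝ (λ α → 0ℝ ≤ α) → Carrier → Carrier
      ‖_‖     : Carrier → ℝ
      isCommutativeMonoid : IsCommutativeMonoid _≡_ _⊕_ 𝟘
      ·-distribʳ : ∀ α β (p : 0ℝ ≤ α) (q : 0ℝ ≤ β) (r : 0ℝ ≤ α + β) x →
                   (α + β , r) · x ≡ (α , p) · x ⊕ (β , q) · x
      ·-distribˡ : ∀ a x y → a · (x ⊕ y) ≡ a · x ⊕ a · y
      ·-assoc    : ∀ α β (p : 0ℝ ≤ α) (q : 0ℝ ≤ β) (r : 0ℝ ≤ α * β) x →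
                   (α * β , r) · x ≡ (α , p) · ((β , q) · x)
      ·-identity : ∀ (p : 0ℝ ≤ 1ℝ) x → (1ℝ , p) · x ≡ x
      ·-zeroˡ    : ∀ (p : 0ℝ ≤ 0ℝ) x → (0ℝ , p) · x ≡ 𝟘
      ·-zeroʳ    : ∀ a → a · 𝟘 ≡ 𝟘
      ‖‖-nonneg  : ∀ x → 0ℝ ≤ ‖ x ‖
      cancel     : ∀ x y y' → x ⊕ y ≡ x ⊕ y' → y ≡ y'
      ‖‖-homog   : ∀ α (p : 0ℝ ≤ α) x → ‖ (α , p) · x ‖ ≡ α * ‖ x ‖
      ‖‖-subadd  : ∀ x x' → ‖ x ⊕ x' ‖ ≤ ‖ x ‖ + ‖ x' ‖
      ‖‖-definite : ∀ x → ‖ x ‖ ≡ 0ℝ → x ≡ 𝟘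
      ‖‖-mono    : ∀ x x' → ‖ x ‖ ≤ ‖ x ⊕ x' ‖

    _≼_ : Carrier → Carrier → Set
    x ≼ y = ∃ λ z → y ≡ x ⊕ z

    IsLub : Carrier → Carrier → Carrier → Set
    IsLub x y s = x ≼ s × y ≼ s × (∀ w → x ≼ w → y ≼ w → s ≼ w)

    Σ⊕ : List Carrier → Carrier
    Σ⊕ = foldr _⊕_ 𝟘

    -- partitions are finite multisets, represented by lists
    -- (multisets = lists up to permutation _↭_)
    IsPartition : List Carrier → Carrier → Set
    IsPartition π x = Σ⊕ π ≡ x

    Refines : List Carrier → List Carrier → Set
    Refines π' π = ∃ λ (αs : List (List Carrier)) →
      Pointwise IsPartition αs π × (π' ↭ concat αs)

  IsLatticeCone : Cone → Set
  IsLatticeCone C = ∀ x y → ∃ λ s → IsLub x y s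
    where open Cone C

-- A lattice cone has the Riesz decomposition property: if a ≼ b + c then
-- a = a₁ + a₂ with a₁ ≼ b and a₂ ≼ c, where a₁ is the difference
-- (a + b) − (a ∨ b).  Iterating, the first block y of π₁ splits as
-- y = w₁ + ⋯ + wₘ with each wⱼ below the j-th block zⱼ of π₂.  The rest of
-- π₁ and the residues zⱼ − wⱼ are then two partitions of the same element,
-- and a common refinement of them, prefixed by the wⱼ, refines π₁ and π₂.
module Submission where

open import Defs
open import Data.Product using (∃; ∃₂; _×_; _,_)
open import Data.List using (List; []; _∷_; _++_; concat)
open import Data.List.Relation.Binary.Pointwise using ([]; _∷_)
open import Data.List.Relation.Binary.Permutation.Propositional
  using (↭-refl; ↭-trans; ↭-prep)
open import Data.List.Relation.Binary.Permutation.Propositional.Properties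
  using (++⁺ˡ; shifts)
open import Relation.Binary.PropositionalEquality
  using (_≡_; refl; sym; trans; cong; cong₂; subst; module ≡-Reasoning)
open import Relation.Binary.Structures using (IsTotalOrder)
open import Algebra.Structures using (IsCommutativeRing; IsCommutativeMonoid)

module _ (Rl : RealNumbers) (C : Cone Rl) where
  open RealNumbers Rl
  open Cone C
  open IsCommutativeMonoid isCommutativeMonoid using (assoc; comm; identityˡ)
  open ≡-Reasoning

  ‖𝟘‖≡0 : ‖ 𝟘 ‖ ≡ 0ℝ
  ‖𝟘‖≡0 = begin
    ‖ 𝟘 ‖                   ≡⟨ cong ‖_‖ (sym (·-zeroˡ ≤-refl 𝟘)) ⟩
    ‖ (0ℝ , ≤-refl) · 𝟘 ‖   ≡⟨ ‖‖-homog 0ℝ ≤-refl 𝟘 ⟩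
    0ℝ * ‖ 𝟘 ‖              ≡⟨ IsCommutativeRing.zeroˡ isCommutativeRing ‖ 𝟘 ‖ ⟩
    0ℝ                      ∎
    where open IsTotalOrder isTotalOrder renaming (refl to ≤-refl)

  ⊕≡𝟘⇒≡𝟘 : ∀ a b → a ⊕ b ≡ 𝟘 → a ≡ 𝟘
  ⊕≡𝟘⇒≡𝟘 a b a⊕b≡𝟘 = ‖‖-definite a (antisym ‖a‖≤0 (‖‖-nonneg a))
    where
    open IsTotalOrder isTotalOrder using (antisym)
    ‖a‖≤0 : ‖ a ‖ ≤ 0ℝ
    ‖a‖≤0 = subst (‖ a ‖ ≤_) (trans (cong ‖_‖ a⊕b≡𝟘) ‖𝟘‖≡0) (‖‖-mono a b)

  ⊕-cancelˡ-assoc : ∀ p q r t → p ⊕ q ≡ (p ⊕ r) ⊕ t → q ≡ r ⊕ t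
  ⊕-cancelˡ-assoc p q r t eq = cancel p q (r ⊕ t) (trans eq (assoc p r t))

  Σ⊕-++ : ∀ xs ys → Σ⊕ (xs ++ ys) ≡ Σ⊕ xs ⊕ Σ⊕ ys
  Σ⊕-++ []       ys = sym (identityˡ (Σ⊕ ys))
  Σ⊕-++ (x ∷ xs) ys = trans (cong (x ⊕_) (Σ⊕-++ xs ys)) (sym (assoc x (Σ⊕ xs) (Σ⊕ ys)))

  data PointwiseSum : List Carrier → List Carrier → List Carrier → Set where
    []  : PointwiseSum [] [] []
    _∷_ : ∀ {w r z ws rs zs} → z ≡ w ⊕ r → PointwiseSum ws rs zs →
          PointwiseSum (w ∷ ws) (r ∷ rs) (z ∷ zs)

  Σ⊕-PointwiseSum : ∀ {ws rs zs} → PointwiseSum ws rs zs → Σ⊕ zs ≡ Σ⊕ ws ⊕ Σ⊕ rs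
  Σ⊕-PointwiseSum [] = sym (identityˡ 𝟘)
  Σ⊕-PointwiseSum {w ∷ ws} {r ∷ rs} {z ∷ zs} (z≡w⊕r ∷ sums) = begin
    z ⊕ Σ⊕ zs                  ≡⟨ cong₂ _⊕_ z≡w⊕r (Σ⊕-PointwiseSum sums) ⟩
    (w ⊕ r) ⊕ (Σ⊕ ws ⊕ Σ⊕ rs)  ≡⟨ assoc w r _ ⟩
    w ⊕ (r ⊕ (Σ⊕ ws ⊕ Σ⊕ rs))  ≡⟨ cong (w ⊕_) (sym (assoc r (Σ⊕ ws) (Σ⊕ rs))) ⟩
    w ⊕ ((r ⊕ Σ⊕ ws) ⊕ Σ⊕ rs)  ≡⟨ cong (λ u → w ⊕ (u ⊕ Σ⊕ rs)) (comm r (Σ⊕ ws)) ⟩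
    w ⊕ ((Σ⊕ ws ⊕ r) ⊕ Σ⊕ rs)  ≡⟨ cong (w ⊕_) (assoc (Σ⊕ ws) r (Σ⊕ rs)) ⟩
    w ⊕ (Σ⊕ ws ⊕ (r ⊕ Σ⊕ rs))  ≡⟨ sym (assoc w _ _) ⟩
    (w ⊕ Σ⊕ ws) ⊕ (r ⊕ Σ⊕ rs)  ∎

  Refines-[] : ∀ zs → Σ⊕ zs ≡ 𝟘 → Refines [] zs
  Refines-[] []       _       = [] , [] , ↭-refl
  Refines-[] (z ∷ zs) Σ⊕≡𝟘 with Refines-[] zs (⊕≡𝟘⇒≡𝟘 (Σ⊕ zs) z (trans (comm (Σ⊕ zs) z) Σ⊕≡𝟘))
  ... | αs , partitions , []↭ = [] ∷ αs , sym (⊕≡𝟘⇒≡𝟘 z (Σ⊕ zs) Σ⊕≡𝟘) ∷ partitions , []↭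

  Refines-∷ : ∀ {ws y π ys} → Σ⊕ ws ≡ y → Refines π ys → Refines (ws ++ π) (y ∷ ys)
  Refines-∷ {ws} Σws≡y (αs , partitions , π↭) = ws ∷ αs , Σws≡y ∷ partitions , ++⁺ˡ ws π↭

  Refines-PointwiseSum : ∀ {ws rs zs π} → PointwiseSum ws rs zs → Refines π rs →
                         Refines (ws ++ π) zs
  Refines-PointwiseSum [] ([] , [] , π↭) = [] , [] , π↭
  Refines-PointwiseSum {w ∷ ws} (z≡w⊕r ∷ sums) (α ∷ αs , Σα≡r ∷ partitions , π↭)
    with Refines-PointwiseSum {π = concat αs} sums (αs , partitions , ↭-refl)
  ... | βs , partitionsβ , ws++αs↭ =
    (w ∷ α) ∷ βs ,
    trans (cong (w ⊕_) Σα≡r) (sym z≡w⊕r) ∷ partitionsβ ,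
    ↭-prep w (↭-trans (++⁺ˡ ws π↭)
             (↭-trans (shifts ws α) (++⁺ˡ α ws++αs↭)))

  module _ (isLattice : IsLatticeCone Rl C) where

    riesz-decomposition : ∀ a b c → a ≼ (b ⊕ c) →
      ∃₂ λ a₁ a₂ → a ≡ a₁ ⊕ a₂ × a₁ ≼ b × a₂ ≼ c
    riesz-decomposition a b c (d , b⊕c≡a⊕d) with isLattice a b
    ... | s , (e , s≡a⊕e) , (f , s≡b⊕f) , least
      with least (a ⊕ b) (b , refl) (a , comm a b) | least (b ⊕ c) (d , b⊕c≡a⊕d) (c , refl)
    ... | m , a⊕b≡s⊕m | g , b⊕c≡s⊕g =
      m , f ,
      trans (⊕-cancelˡ-assoc b a f m (trans (comm b a) (trans a⊕b≡s⊕m (cong (_⊕ m) s≡b⊕f))))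
            (comm f m) ,
      (e , trans (⊕-cancelˡ-assoc a b e m (trans a⊕b≡s⊕m (cong (_⊕ m) s≡a⊕e))) (comm e m)) ,
      (g , ⊕-cancelˡ-assoc b c f g (trans b⊕c≡s⊕g (cong (_⊕ g) s≡b⊕f)))

    ≼Σ⊕-decomposition : ∀ a zs → a ≼ Σ⊕ zs →
      ∃₂ λ ws rs → PointwiseSum ws rs zs × Σ⊕ ws ≡ a
    ≼Σ⊕-decomposition a []       (d , 𝟘≡a⊕d) = [] , [] , [] , sym (⊕≡𝟘⇒≡𝟘 a d (sym 𝟘≡a⊕d))
    ≼Σ⊕-decomposition a (z ∷ zs) a≼Σ with riesz-decomposition a z (Σ⊕ zs) a≼Σ
    ... | a₁ , a₂ , a≡a₁⊕a₂ , (r , z≡a₁⊕r) , a₂≼Σzs with ≼Σ⊕-decomposition a₂ zs a₂≼Σzs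
    ... | ws , rs , sums , Σws≡a₂ =
      a₁ ∷ ws , r ∷ rs , z≡a₁⊕r ∷ sums , trans (cong (a₁ ⊕_) Σws≡a₂) (sym a≡a₁⊕a₂)

    common-refinement : ∀ π₁ π₂ → Σ⊕ π₁ ≡ Σ⊕ π₂ →
      ∃ λ π → Σ⊕ π ≡ Σ⊕ π₁ × Refines π π₁ × Refines π π₂
    common-refinement []       π₂ 𝟘≡Σπ₂ = [] , refl , ([] , [] , ↭-refl) , Refines-[] π₂ (sym 𝟘≡Σπ₂)
    common-refinement (y ∷ ys) π₂ Σπ₁≡Σπ₂
      with ≼Σ⊕-decomposition y π₂ (Σ⊕ ys , sym Σπ₁≡Σπ₂)
    ... | ws , rs , sums , Σws≡y with common-refinement ys rs Σys≡Σrs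
      where
      Σys≡Σrs : Σ⊕ ys ≡ Σ⊕ rs
      Σys≡Σrs = cancel y (Σ⊕ ys) (Σ⊕ rs) (begin
        y ⊕ Σ⊕ ys       ≡⟨ Σπ₁≡Σπ₂ ⟩
        Σ⊕ π₂           ≡⟨ Σ⊕-PointwiseSum sums ⟩
        Σ⊕ ws ⊕ Σ⊕ rs   ≡⟨ cong (_⊕ Σ⊕ rs) Σws≡y ⟩
        y ⊕ Σ⊕ rs       ∎)
    ... | π , Σπ≡Σys , π≺ys , π≺rs =
      ws ++ π ,
      trans (Σ⊕-++ ws π) (cong₂ _⊕_ Σws≡y Σπ≡Σys) ,
      Refines-∷ Σws≡y π≺ys ,
      Refines-PointwiseSum sums π≺rs

lemma3p7 : (Rl : RealNumbers) (C : Cone Rl) → IsLatticeCone Rl C →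
    ∀ (x : Cone.Carrier C) (π₁ π₂ : List (Cone.Carrier C)) →
    Cone.IsPartition C π₁ x → Cone.IsPartition C π₂ x →
    ∃ λ (π : List (Cone.Carrier C)) →
    Cone.IsPartition C π x × Cone.Refines C π π₁ × Cone.Refines C π π₂
lemma3p7 Rl C isLattice x π₁ π₂ Σπ₁≡x Σπ₂≡x
  with common-refinement Rl C isLattice π₁ π₂ (trans Σπ₁≡x (sym Σπ₂≡x))
... | π , Σπ≡Σπ₁ , π≺π₁ , π≺π₂ = π , trans Σπ≡Σπ₁ Σπ₁≡x , π≺π₁ , π≺π₂
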